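{- There is a universal constant $\gamma$ such that the following holds. Let $\varepsilon>0$ and let $f:\{ -1,1\}^n\to\{ -1,1\}$ be $\rho$-SP for every $\rho\in(1-\varepsilon,1]$, where $n>\max\{2\varepsilon^{ -1},\gamma\}$. Then every $x^n\in\{ -1,1\}^n$ has a radius-$2$ friendly neighborhood with respect to $f$, i.e., there exists $y^n\in\{ -1,1\}^n$ with $1\le d_H(x^n,y^n)\le 2$ and $f(y^n)=f(x^n)$.
   Context: $d_H$ denotes Hamming distance. For $\rho\in[0,1]$ and $f:\{ -1,1\}^n\to\{ -1,1\}$, $T_\rho f(y^n)=\mathbb{E}[f(X^n)\mid Y^n=y^n]=\sum_{S\subseteq[n]}\rho^{|S|}\hat f_S y^S$, where $X^n$ is uniform on $\{ -1,1\}^n$, $Y^n$ is obtained by flipping each coordinate of $X^n$ independently with probability $(1-\rho)/2$, $y^S=\prod_{i\in S}y_i$, $\hat f_S=\mathbb{E}[f(X^n)X^S]$. $\operatorname{sgn}(0)=0$. $f$ is $\rho$-SP if for every $y^n$, $f(y^n)=\operatorname{sgn}T_\rho f(y^n)$ whenever $T_\rho f(y^n)\neq0$.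
   Formalization: The parameter ε ranges over ℚ, and the values of ρ in $(1-\varepsilon,1]$ at which f is assumed ρ-SP are taken in ℚ as well. -}

module Defs where

open import Data.Nat as ℕ using (ℕ; zero; suc)
open import Data.Integer as ℤ using (ℤ; +_; -[1+_])
open import Data.Rational using (ℚ; 0ℚ; 1ℚ; _+_; _*_; -_; _/_; _<_)
open import Data.Rational.Properties using (_<?_; _≟_)
open import Data.Nat.Properties using (m*n≢0)
open import Data.Sign using (Sign)
open import Data.Bool using (Bool; true; false)
open import Data.Vec using (Vec; []; _∷_)
open import Data.List using (List; []; _∷_; map; _++_; foldr)
open import Relation.Nullary using (yes; no)
open import Relation.Binary.PropositionalEquality using (_≡_; _≢_)

-- The cube {-1,1}^n : vectors of signs (Sign.- ↦ -1, Sign.+ ↦ +1).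
Cube : ℕ → Set
Cube n = Vec Sign n

BoolFun : ℕ → Set
BoolFun n = Cube n → Sign

val : Sign → ℚ
val Sign.+ = 1ℚ
val Sign.- = - 1ℚ

allPoints : (n : ℕ) → List (Cube n)
allPoints zero = [] ∷ []
allPoints (suc n) =
  map (Sign.- ∷_) (allPoints n) ++ map (Sign.+ ∷_) (allPoints n)

Subset : ℕ → Set
Subset n = Vec Bool n

allSubsets : (n : ℕ) → List (Subset n)
allSubsets zero = [] ∷ []
allSubsets (suc n) =
  map (false ∷_) (allSubsets n) ++ map (true ∷_) (allSubsets n)

card : ∀ {n} → Subset n → ℕ
card [] = 0
card (false ∷ S) = card S
card (true ∷ S) = suc (card S)

chi : ∀ {n} → Subset n → Cube n → ℚ
chi [] [] = 1ℚ
chi (false ∷ S) (_ ∷ y) = chi S y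
chi (true ∷ S) (s ∷ y) = val s * chi S y

sumℚ : List ℚ → ℚ
sumℚ = foldr _+_ 0ℚ

powℚ : ℚ → ℕ → ℚ
powℚ q zero = 1ℚ
powℚ q (suc k) = q * powℚ q k

two^ : ℕ → ℕ
two^ zero = 1
two^ (suc n) = 2 ℕ.* two^ n

-- Fourier coefficient  \hat f_S = E[f(X) X^S] = 2^{-n} Σ_x f(x) x^S
fourier : ∀ {n} → BoolFun n → Subset n → ℚ
fourier {n} f S =
  sumℚ (map (λ x → val (f x) * chi S x) (allPoints n))
  * ((+ 1) / two^ n) {{nz n}}
  where
  nz : (m : ℕ) → ℕ.NonZero (two^ m)
  nz zero = _
  nz (suc m) = m*n≢0 2 (two^ m) {{_}} {{nz m}}

T : ∀ {n} → ℚ → BoolFun n → Cube n → ℚ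
T {n} ρ f y =
  sumℚ (map (λ S → powℚ ρ (card S) * fourier f S * chi S y) (allSubsets n))

-- sgn : ℚ → ℤ with sgn 0 = 0
sgn : ℚ → ℤ
sgn q with q <? 0ℚ
... | yes _ = -[1+ 0 ]
... | no _ with q ≟ 0ℚ
...   | yes _ = + 0
...   | no _ = + 1

signℤ : Sign → ℤ
signℤ Sign.+ = + 1
signℤ Sign.- = -[1+ 0 ]

IsSP : ∀ {n} → ℚ → BoolFun n → Set
IsSP ρ f = ∀ y → T ρ f y ≢ 0ℚ → signℤ (f y) ≡ sgn (T ρ f y)

dH : ∀ {n} → Cube n → Cube n → ℕ
dH [] [] = 0
dH (Sign.+ ∷ x) (Sign.+ ∷ y) = dH x y
dH (Sign.- ∷ x) (Sign.- ∷ y) = dH x y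
dH (Sign.+ ∷ x) (Sign.- ∷ y) = suc (dH x y)
dH (Sign.- ∷ x) (Sign.+ ∷ y) = suc (dH x y)

module Submission where

-- Let n = k+2 ≥ 2 and ρ = 1 - ℓ with ℓ = 2/n; the hypothesis 2 < nε puts ρ in
-- (1-ε, 1], so f is ρ-SP.  Expanding the Fourier coefficients and swapping the sums gives
--   f(x)·T_ρ f(x) = 2^{-n} Σ_z K_ρ(z,x) f(x) f(z),   K_ρ(z,x) = ∏ᵢ (1 + ρ zᵢ xᵢ) ≥ 0,
-- and K_ρ(z,x) = (1+ρ)^{n-d} (1-ρ)^d only depends on d = d_H(x,z).  If no z with
-- 1 ≤ d ≤ 2 had f(z) = f(x), then f(x)f(z) ≤ G(d), where G = -1 on {1,2} and 1 elsewhere,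
-- so f(x)·T_ρ f(x) ≤ 2^{-n} R(G) with the "radial sum"
--   R(G) = Σ_d C(n,d) A^{n-d} B^d G(d) = (A+B)^n - 2nA^{n-1}B - n(n-1)A^{n-2}B²,
-- A = 1+ρ = ℓ(n-1), B = 1-ρ = ℓ.  This equals ℓⁿ n (n^{n-1} - 3(n-1)^{n-1}) < 0 because
-- (1 + 1/M)^M < 3, contradicting the ρ-SP property at x.

open import Defs
open import Data.Nat as ℕ using (ℕ; zero; suc)
open import Data.Nat.Properties as ℕP using (m*n≢0)
open import Data.Integer as ℤ using (+_; -[1+_])
import Data.Integer.Tactic.RingSolver as ℤ-Solver
open import Data.Rational using (ℚ; 0ℚ; 1ℚ; _<_; _≤_; _-_; _*_; _/_; _+_; -_; 1/_; toℚᵘ)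
import Data.Rational as Q
import Data.Rational.Properties as QP
import Data.Rational.Unnormalised as U
import Data.Rational.Unnormalised.Properties as UP
open import Data.Sign using (Sign; opposite)
import Data.Sign.Properties as SignP
open import Data.Bool using (false; true)
open import Data.Vec using (Vec; []; _∷_)
open import Data.List using (List; []; _∷_; map; _++_)
open import Data.List.Relation.Unary.All as All using (All; []; _∷_)
open import Data.List.Relation.Unary.All.Properties using (¬Any⇒All¬)
open import Data.List.Relation.Unary.Any using (any?; satisfied)
open import Data.Product using (Σ; _×_; _,_; ∃-syntax)
open import Data.Empty using (⊥-elim)
open import Level using (0ℓ)
open import Relation.Nullary using (¬_; Dec; yes; no; contradiction)
open import Relation.Nullary.Decidable using (_×-dec_; dec⇒maybe)
open import Relation.Binary.PropositionalEquality
open import Tactic.RingSolver using (solve-∀)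
open import Tactic.RingSolver.Core.AlmostCommutativeRing using (AlmostCommutativeRing; fromCommutativeRing)

ℚ-ring : AlmostCommutativeRing 0ℓ 0ℓ
ℚ-ring = fromCommutativeRing QP.+-*-commutativeRing (λ q → dec⇒maybe (0ℚ QP.≟ q))

two three : ℚ
two = 1ℚ + 1ℚ
three = two + 1ℚ

0<1 : 0ℚ < 1ℚ
0<1 = QP.positive⁻¹ 1ℚ

0≤two : 0ℚ ≤ two
0≤two = QP.<⇒≤ (QP.positive⁻¹ two)

nonneg-+ : ∀ {p q} → 0ℚ ≤ p → 0ℚ ≤ q → 0ℚ ≤ p + q
nonneg-+ = QP.+-mono-≤

pos-+ : ∀ {p q} → 0ℚ < p → 0ℚ ≤ q → 0ℚ < p + q
pos-+ = QP.+-mono-<-≤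

nonneg-* : ∀ {p q} → 0ℚ ≤ p → 0ℚ ≤ q → 0ℚ ≤ p * q
nonneg-* {p} {q} 0≤p 0≤q =
  QP.nonNegative⁻¹ _ {{QP.nonNeg*nonNeg⇒nonNeg p {{Q.nonNegative 0≤p}} q {{Q.nonNegative 0≤q}}}}

pos-* : ∀ {p q} → 0ℚ < p → 0ℚ < q → 0ℚ < p * q
pos-* {p} {q} 0<p 0<q = QP.positive⁻¹ _ {{QP.pos*pos⇒pos p {{Q.positive 0<p}} q {{Q.positive 0<q}}}}

*-monoˡ-≤ : ∀ {r p q} → 0ℚ ≤ r → p ≤ q → r * p ≤ r * q
*-monoˡ-≤ {r} 0≤r = QP.*-monoˡ-≤-nonNeg r {{Q.nonNegative 0≤r}}

*-monoˡ-< : ∀ {r p q} → 0ℚ < r → p < q → r * p < r * q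
*-monoˡ-< {r} 0<r = QP.*-monoʳ-<-pos r {{Q.positive 0<r}}

*-cancelˡ-< : ∀ {r p q} → 0ℚ < r → r * p < r * q → p < q
*-cancelˡ-< {r} 0<r = QP.*-cancelˡ-<-nonNeg r {{Q.nonNegative (QP.<⇒≤ 0<r)}}

pos*neg : ∀ {p q} → 0ℚ < p → q < 0ℚ → p * q < 0ℚ
pos*neg {p} 0<p q<0 = subst (p * _ <_) (QP.*-zeroʳ p) (*-monoˡ-< 0<p q<0)

add-difference : ∀ x y → x + (y - x) ≡ y
add-difference = solve-∀ ℚ-ring

≤-from-diff : ∀ {x y} → 0ℚ ≤ y - x → x ≤ y
≤-from-diff {x} {y} h = subst₂ _≤_ (QP.+-identityʳ x) (add-difference x y) (QP.+-monoʳ-≤ x h)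

<-from-diff : ∀ {x y} → 0ℚ < y - x → x < y
<-from-diff {x} {y} h = subst₂ _<_ (QP.+-identityʳ x) (add-difference x y) (QP.+-monoʳ-< x h)

diff-nonneg : ∀ {x y} → x ≤ y → 0ℚ ≤ y - x
diff-nonneg {x} {y} h = subst (_≤ y - x) (QP.+-inverseʳ x) (QP.+-monoˡ-≤ (- x) h)

diff-neg : ∀ {x y} → x < y → x - y < 0ℚ
diff-neg {x} {y} h = subst (x - y <_) (QP.+-inverseʳ y) (QP.+-monoˡ-< (- y) h)

pow-nonneg : ∀ {a} n → 0ℚ ≤ a → 0ℚ ≤ powℚ a n
pow-nonneg zero _ = QP.<⇒≤ 0<1
pow-nonneg (suc n) 0≤a = nonneg-* 0≤a (pow-nonneg n 0≤a)

pow-pos : ∀ {a} n → 0ℚ < a → 0ℚ < powℚ a n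
pow-pos zero _ = 0<1
pow-pos (suc n) 0<a = pos-* 0<a (pow-pos n 0<a)

pow-mul : ∀ a b n → powℚ (a * b) n ≡ powℚ a n * powℚ b n
pow-mul a b zero = refl
pow-mul a b (suc n) = trans (cong (a * b *_) (pow-mul a b n)) (interchange a b (powℚ a n) (powℚ b n))
  where
  interchange : ∀ a b x y → a * b * (x * y) ≡ a * x * (b * y)
  interchange = solve-∀ ℚ-ring

∑ : {A : Set} → List A → (A → ℚ) → ℚ
∑ xs g = sumℚ (map g xs)

infix 5 ∑
syntax ∑ xs (λ x → e) = ∑[ x ∈ xs ] e

sum-cong : ∀ {A : Set} (xs : List A) {g h : A → ℚ} → (∀ x → g x ≡ h x) → ∑ xs g ≡ ∑ xs h
sum-cong [] _ = refl
sum-cong (x ∷ xs) g≡h = cong₂ _+_ (g≡h x) (sum-cong xs g≡h)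

sum-++ : ∀ {A : Set} (xs ys : List A) (g : A → ℚ) → ∑ (xs ++ ys) g ≡ ∑ xs g + ∑ ys g
sum-++ [] ys g = sym (QP.+-identityˡ _)
sum-++ (x ∷ xs) ys g = trans (cong (_+_ (g x)) (sum-++ xs ys g)) (sym (QP.+-assoc (g x) _ _))

sum-map : ∀ {A B : Set} (xs : List A) (h : A → B) (g : B → ℚ) → ∑ (map h xs) g ≡ ∑[ x ∈ xs ] g (h x)
sum-map [] h g = refl
sum-map (x ∷ xs) h g = cong (_+_ (g (h x))) (sum-map xs h g)

sum-+ : ∀ {A : Set} (xs : List A) (g h : A → ℚ) → ∑[ x ∈ xs ] (g x + h x) ≡ ∑ xs g + ∑ xs h
sum-+ [] g h = refl
sum-+ (x ∷ xs) g h = trans (cong (_+_ (g x + h x)) (sum-+ xs g h)) (medial (g x) (h x) (∑ xs g) (∑ xs h))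
  where
  medial : ∀ a b c d → a + b + (c + d) ≡ (a + c) + (b + d)
  medial = solve-∀ ℚ-ring

sum-scale : ∀ {A : Set} (xs : List A) (k : ℚ) (g : A → ℚ) → ∑[ x ∈ xs ] k * g x ≡ k * ∑ xs g
sum-scale [] k g = sym (QP.*-zeroʳ k)
sum-scale (x ∷ xs) k g = trans (cong (_+_ (k * g x)) (sum-scale xs k g)) (sym (QP.*-distribˡ-+ k (g x) _))

sum-zero : ∀ {A : Set} (xs : List A) → ∑[ x ∈ xs ] 0ℚ ≡ 0ℚ
sum-zero [] = refl
sum-zero (x ∷ xs) = cong (_+_ (0ℚ)) (sum-zero xs)

sum-swap : ∀ {A B : Set} (xs : List A) (ys : List B) (F : A → B → ℚ) →
  ∑[ a ∈ xs ] (∑[ b ∈ ys ] F a b) ≡ ∑[ b ∈ ys ] (∑[ a ∈ xs ] F a b)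
sum-swap [] ys F = sym (sum-zero ys)
sum-swap (x ∷ xs) ys F = trans (cong (_+_ (∑ ys (F x))) (sum-swap xs ys F)) (sym (sum-+ ys (F x) _))

sum-mono : ∀ {A : Set} (xs : List A) {g h : A → ℚ} → All (λ x → g x ≤ h x) xs → ∑ xs g ≤ ∑ xs h
sum-mono [] [] = QP.≤-refl
sum-mono (x ∷ xs) (g≤h ∷ gs≤hs) = QP.+-mono-≤ g≤h (sum-mono xs gs≤hs)

sum-split : ∀ {A : Set} {n} (vs : List (Vec A n)) (a b : A) (F : Vec A (suc n) → ℚ) →
  ∑ (map (a ∷_) vs ++ map (b ∷_) vs) F ≡ (∑[ v ∈ vs ] F (a ∷ v)) + (∑[ v ∈ vs ] F (b ∷ v))
sum-split vs a b F = trans (sum-++ (map (a ∷_) vs) (map (b ∷_) vs) F) (cong₂ _+_ (sum-map vs (a ∷_) F) (sum-map vs (b ∷_) F))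

sum-cube : ∀ n (s : Sign) (F : Cube (suc n) → ℚ) →
  ∑ (allPoints (suc n)) F ≡ (∑[ z ∈ allPoints n ] F (s ∷ z)) + (∑[ z ∈ allPoints n ] F (opposite s ∷ z))
sum-cube n Sign.- F = sum-split (allPoints n) Sign.- Sign.+ F
sum-cube n Sign.+ F =
  trans (sum-split (allPoints n) Sign.- Sign.+ F) (QP.+-comm (∑[ z ∈ allPoints n ] F (Sign.- ∷ z)) _)

-- The natural numbers inside ℚ, by the recursion n+1 = 1 + n (so that the ring solver sees
-- the relation between consecutive values), and its agreement with the library embedding.

nat : ℕ → ℚ
nat zero = 0ℚ
nat (suc n) = 1ℚ + nat n

nat≡/1 : ∀ n → nat n ≡ (+ n) / 1
nat≡/1 zero = refl
nat≡/1 (suc n) = QP.toℚᵘ-injective (begin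
  toℚᵘ (1ℚ + nat n)              ≈⟨ QP.toℚᵘ-homo-+ 1ℚ (nat n) ⟩
  toℚᵘ 1ℚ U.+ toℚᵘ (nat n)        ≈⟨ UP.+-congʳ (toℚᵘ 1ℚ) (QP.toℚᵘ-cong (nat≡/1 n)) ⟩
  toℚᵘ 1ℚ U.+ toℚᵘ ((+ n) / 1)    ≈⟨ UP.+-congʳ (toℚᵘ 1ℚ) (QP.toℚᵘ-fromℚᵘ (U.mkℚᵘ (+ n) 0)) ⟩
  U.1ℚᵘ U.+ U.mkℚᵘ (+ n) 0        ≈⟨ U.*≡* (cross-multiply (+ n)) ⟩
  U.mkℚᵘ (+ suc n) 0              ≈⟨ UP.≃-sym (QP.toℚᵘ-fromℚᵘ (U.mkℚᵘ (+ suc n) 0)) ⟩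
  toℚᵘ ((+ suc n) / 1)            ∎)
  where
  open UP.≃-Reasoning
  cross-multiply : ∀ i → (+ 1 ℤ.* + 1 ℤ.+ i ℤ.* + 1) ℤ.* + 1 ≡ (+ 1 ℤ.+ i) ℤ.* (+ 1 ℤ.* + 1)
  cross-multiply = ℤ-Solver.solve-∀

nat-nonneg : ∀ n → 0ℚ ≤ nat n
nat-nonneg zero = QP.≤-refl
nat-nonneg (suc n) = nonneg-+ (QP.<⇒≤ 0<1) (nat-nonneg n)

nat-pos : ∀ n → 0ℚ < nat (suc n)
nat-pos n = pos-+ 0<1 (nat-nonneg n)

nat-mono : ∀ {m n} → m ℕ.≤ n → nat m ≤ nat n
nat-mono {n = n} ℕ.z≤n = nat-nonneg n
nat-mono (ℕ.s≤s m≤n) = QP.+-monoʳ-≤ 1ℚ (nat-mono m≤n)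

weight : ℚ → Sign → Sign → ℚ
weight ρ s t = 1ℚ + ρ * (val s * val t)

kernel : ℚ → ∀ {n} → Cube n → Cube n → ℚ
kernel ρ [] [] = 1ℚ
kernel ρ (s ∷ x) (t ∷ y) = weight ρ s t * kernel ρ x y

weight-same : ∀ ρ s → weight ρ s s ≡ 1ℚ + ρ
weight-same ρ Sign.+ = cong (_+_ (1ℚ)) (QP.*-identityʳ ρ)
weight-same ρ Sign.- = cong (_+_ (1ℚ)) (QP.*-identityʳ ρ)

weight-opposite : ∀ ρ s → weight ρ (opposite s) s ≡ 1ℚ - ρ
weight-opposite ρ Sign.+ = minus-one ρ
  where
  minus-one : ∀ r → 1ℚ + r * (- 1ℚ) ≡ 1ℚ - r
  minus-one = solve-∀ ℚ-ring
weight-opposite ρ Sign.- = weight-opposite ρ Sign.+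

kernel-nonneg : ∀ ρ → 0ℚ ≤ 1ℚ + ρ → 0ℚ ≤ 1ℚ - ρ → ∀ {n} (z x : Cube n) → 0ℚ ≤ kernel ρ z x
kernel-nonneg ρ 0≤A 0≤B [] [] = QP.<⇒≤ 0<1
kernel-nonneg ρ 0≤A 0≤B (t ∷ z) (s ∷ x) = nonneg-* (weight-nonneg t s) (kernel-nonneg ρ 0≤A 0≤B z x)
  where
  weight-nonneg : ∀ t s → 0ℚ ≤ weight ρ t s
  weight-nonneg Sign.+ Sign.+ = subst (0ℚ ≤_) (sym (weight-same ρ Sign.+)) 0≤A
  weight-nonneg Sign.- Sign.- = subst (0ℚ ≤_) (sym (weight-same ρ Sign.-)) 0≤A
  weight-nonneg Sign.- Sign.+ = subst (0ℚ ≤_) (sym (weight-opposite ρ Sign.+)) 0≤B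
  weight-nonneg Sign.+ Sign.- = subst (0ℚ ≤_) (sym (weight-opposite ρ Sign.-)) 0≤B

kernel-expansion : ∀ ρ n (x y : Cube n) →
  ∑[ S ∈ allSubsets n ] powℚ ρ (card S) * chi S x * chi S y ≡ kernel ρ x y
kernel-expansion ρ zero [] [] = refl
kernel-expansion ρ (suc n) (s ∷ x) (t ∷ y) = begin
  ∑ (allSubsets (suc n)) F
    ≡⟨ sum-split Ss false true F ⟩
  ∑ Ss F′ + (∑[ S ∈ Ss ] F (true ∷ S))
    ≡⟨ cong (_+_ (∑ Ss F′)) (sum-cong Ss λ S →
         regroup ρ (powℚ ρ (card S)) (val s) (val t) (chi S x) (chi S y)) ⟩
  ∑ Ss F′ + (∑[ S ∈ Ss ] w * F′ S)
    ≡⟨ cong (_+_ (∑ Ss F′)) (sum-scale Ss w F′) ⟩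
  ∑ Ss F′ + w * ∑ Ss F′
    ≡⟨ cong (λ K → K + w * K) (kernel-expansion ρ n x y) ⟩
  kernel ρ x y + w * kernel ρ x y
    ≡⟨ factor (kernel ρ x y) w ⟩
  weight ρ s t * kernel ρ x y ∎
  where
  open ≡-Reasoning
  Ss : List (Subset n)
  Ss = allSubsets n
  w : ℚ
  w = ρ * (val s * val t)
  F : Subset (suc n) → ℚ
  F S = powℚ ρ (card S) * chi S (s ∷ x) * chi S (t ∷ y)
  F′ : Subset n → ℚ
  F′ S = powℚ ρ (card S) * chi S x * chi S y
  regroup : ∀ r p a b u v → r * p * (a * u) * (b * v) ≡ r * (a * b) * (p * u * v)
  regroup = solve-∀ ℚ-ring
  factor : ∀ K w → K + w * K ≡ (1ℚ + w) * K
  factor = solve-∀ ℚ-ring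

two^-nonZero : ∀ n → ℕ.NonZero (two^ n)
two^-nonZero zero = _
two^-nonZero (suc n) = m*n≢0 2 (two^ n) {{_}} {{two^-nonZero n}}

uniform : ℕ → ℚ
uniform n = ((+ 1) / two^ n) {{two^-nonZero n}}

uniform-pos : ∀ n → 0ℚ < uniform n
uniform-pos n = QP.positive⁻¹ _ {{QP.normalize-pos 1 (two^ n) {{two^-nonZero n}}}}

T-as-kernel : ∀ ρ n (f : BoolFun n) (y : Cube n) →
  T ρ f y ≡ uniform n * (∑[ x ∈ allPoints n ] val (f x) * kernel ρ x y)
T-as-kernel ρ n f y = begin
  T ρ f y
    ≡⟨ sum-cong Ss coefficient ⟩
  ∑[ S ∈ Ss ] κ * (∑[ x ∈ Ps ] val (f x) * term S x)
    ≡⟨ sum-scale Ss κ _ ⟩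
  κ * (∑[ S ∈ Ss ] ∑[ x ∈ Ps ] val (f x) * term S x)
    ≡⟨ cong (κ *_) (sum-swap Ss Ps _) ⟩
  κ * (∑[ x ∈ Ps ] ∑[ S ∈ Ss ] val (f x) * term S x)
    ≡⟨ cong (κ *_) (sum-cong Ps λ x →
         trans (sum-scale Ss (val (f x)) (λ S → term S x)) (cong (val (f x) *_) (kernel-expansion ρ n x y))) ⟩
  κ * (∑[ x ∈ Ps ] val (f x) * kernel ρ x y) ∎
  where
  open ≡-Reasoning
  Ss : List (Subset n)
  Ss = allSubsets n
  Ps : List (Cube n)
  Ps = allPoints n
  κ : ℚ
  κ = uniform n
  term : Subset n → Cube n → ℚ
  term S x = powℚ ρ (card S) * chi S x * chi S y
  rearrange-outer : ∀ p F κ c → p * (F * κ) * c ≡ κ * (p * c * F)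
  rearrange-outer = solve-∀ ℚ-ring
  rearrange-inner : ∀ p c v u → p * c * (v * u) ≡ v * (p * u * c)
  rearrange-inner = solve-∀ ℚ-ring
  coefficient : ∀ S → powℚ ρ (card S) * fourier f S * chi S y ≡ κ * (∑[ x ∈ Ps ] val (f x) * term S x)
  coefficient S = begin
    p * (∑ Ps g * κ) * c       ≡⟨ rearrange-outer p (∑ Ps g) κ c ⟩
    κ * (p * c * ∑ Ps g)       ≡⟨ cong (κ *_) (sym (sum-scale Ps (p * c) g)) ⟩
    κ * (∑[ x ∈ Ps ] p * c * g x) ≡⟨ cong (κ *_) (sum-cong Ps λ x → rearrange-inner p c (val (f x)) (chi S x)) ⟩
    κ * (∑[ x ∈ Ps ] val (f x) * term S x) ∎
    where
    p : ℚ
    p = powℚ ρ (card S)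
    c : ℚ
    c = chi S y
    g : Cube n → ℚ
    g x = val (f x) * chi S x

correlation-as-kernel : ∀ ρ n (f : BoolFun n) (x : Cube n) →
  val (f x) * T ρ f x ≡ uniform n * (∑[ z ∈ allPoints n ] kernel ρ z x * (val (f x) * val (f z)))
correlation-as-kernel ρ n f x = begin
  v * T ρ f x
    ≡⟨ cong (v *_) (T-as-kernel ρ n f x) ⟩
  v * (uniform n * ∑ Ps g)
    ≡⟨ swap-scalars v (uniform n) (∑ Ps g) ⟩
  uniform n * (v * ∑ Ps g)
    ≡⟨ cong (uniform n *_) (sym (sum-scale Ps v g)) ⟩
  uniform n * (∑[ z ∈ Ps ] v * g z)
    ≡⟨ cong (uniform n *_) (sum-cong Ps λ z → rotate v (val (f z)) (kernel ρ z x)) ⟩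
  uniform n * (∑[ z ∈ Ps ] kernel ρ z x * (v * val (f z))) ∎
  where
  open ≡-Reasoning
  Ps : List (Cube n)
  Ps = allPoints n
  v : ℚ
  v = val (f x)
  g : Cube n → ℚ
  g z = val (f z) * kernel ρ z x
  swap-scalars : ∀ a b c → a * (b * c) ≡ b * (a * c)
  swap-scalars = solve-∀ ℚ-ring
  rotate : ∀ a b c → a * (b * c) ≡ c * (a * b)
  rotate = solve-∀ ℚ-ring

-- Radial sums.  radial A B n φ = Σ_d C(n,d) A^{n-d} B^d φ(d), defined through Pascal's rule:
-- the value of a kernel sum against any function of the Hamming distance.

radial : ℚ → ℚ → ℕ → (ℕ → ℚ) → ℚ
radial A B zero φ = φ 0
radial A B (suc n) φ = A * radial A B n φ + B * radial A B n (λ d → φ (suc d))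

dH-same : ∀ s {n} (x z : Cube n) → dH (s ∷ x) (s ∷ z) ≡ dH x z
dH-same Sign.+ x z = refl
dH-same Sign.- x z = refl

dH-opposite : ∀ s {n} (x z : Cube n) → dH (s ∷ x) (opposite s ∷ z) ≡ suc (dH x z)
dH-opposite Sign.+ x z = refl
dH-opposite Sign.- x z = refl

kernel-radial : ∀ ρ n (x : Cube n) (φ : ℕ → ℚ) →
  ∑[ z ∈ allPoints n ] kernel ρ z x * φ (dH x z) ≡ radial (1ℚ + ρ) (1ℚ - ρ) n φ
kernel-radial ρ zero [] φ = unit (φ 0)
  where
  unit : ∀ a → 1ℚ * a + 0ℚ ≡ a
  unit = solve-∀ ℚ-ring
kernel-radial ρ (suc n) (s ∷ x) φ = begin
  ∑ (allPoints (suc n)) F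
    ≡⟨ sum-cube n s F ⟩
  (∑[ z ∈ Ps ] F (s ∷ z)) + (∑[ z ∈ Ps ] F (opposite s ∷ z))
    ≡⟨ cong₂ _+_ (sum-cong Ps same) (sum-cong Ps differ) ⟩
  (∑[ z ∈ Ps ] A * (kernel ρ z x * φ (dH x z))) + (∑[ z ∈ Ps ] B * (kernel ρ z x * φ (suc (dH x z))))
    ≡⟨ cong₂ _+_ (sum-scale Ps A _) (sum-scale Ps B _) ⟩
  A * (∑[ z ∈ Ps ] kernel ρ z x * φ (dH x z)) + B * (∑[ z ∈ Ps ] kernel ρ z x * φ (suc (dH x z)))
    ≡⟨ cong₂ (λ u v → A * u + B * v) (kernel-radial ρ n x φ) (kernel-radial ρ n x (λ d → φ (suc d))) ⟩
  radial A B (suc n) φ ∎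
  where
  open ≡-Reasoning
  Ps : List (Cube n)
  Ps = allPoints n
  A : ℚ
  A = 1ℚ + ρ
  B : ℚ
  B = 1ℚ - ρ
  F : Cube (suc n) → ℚ
  F z = kernel ρ z (s ∷ x) * φ (dH (s ∷ x) z)
  same : ∀ z → F (s ∷ z) ≡ A * (kernel ρ z x * φ (dH x z))
  same z = trans (cong₂ (λ w d → w * kernel ρ z x * φ d) (weight-same ρ s) (dH-same s x z))
                 (QP.*-assoc A _ _)
  differ : ∀ z → F (opposite s ∷ z) ≡ B * (kernel ρ z x * φ (suc (dH x z)))
  differ z = trans (cong₂ (λ w d → w * kernel ρ z x * φ d) (weight-opposite ρ s) (dH-opposite s x z))
                   (QP.*-assoc B _ _)

testProfile : ℕ → ℚ
testProfile 0 = 1ℚ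
testProfile 1 = - 1ℚ
testProfile 2 = - 1ℚ
testProfile (suc (suc (suc _))) = 1ℚ

module RadialTest (A B : ℚ) where

  radial-G₃ : ∀ n → radial A B n (λ d → testProfile (suc (suc (suc d)))) ≡ powℚ (A + B) n
  radial-G₃ zero = refl
  radial-G₃ (suc n) = trans (cong₂ (λ u v → A * u + B * v) (radial-G₃ n) (radial-G₃ n)) (step A B (powℚ (A + B) n))
    where
    step : ∀ a b s → a * s + b * s ≡ (a + b) * s
    step = solve-∀ ℚ-ring

  radial-G₂ : ∀ n → radial A B n (λ d → testProfile (suc (suc d))) ≡ powℚ (A + B) n - two * powℚ A n
  radial-G₂ zero = refl
  radial-G₂ (suc n) = trans (cong₂ (λ u v → A * u + B * v) (radial-G₂ n) (radial-G₃ n))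
                            (step A B (powℚ (A + B) n) (powℚ A n))
    where
    step : ∀ a b s p → a * (s - two * p) + b * s ≡ (a + b) * s - two * (a * p)
    step = solve-∀ ℚ-ring

  radial-G₁ : ∀ m → radial A B (suc m) (λ d → testProfile (suc d))
    ≡ powℚ (A + B) (suc m) - two * powℚ A (suc m) - two * (nat (suc m) * powℚ A m * B)
  radial-G₁ zero = base A B
    where
    base : ∀ a b → a * (- 1ℚ) + b * (- 1ℚ) ≡ (a + b) * 1ℚ - two * (a * 1ℚ) - two * ((1ℚ + 0ℚ) * 1ℚ * b)
    base = solve-∀ ℚ-ring
  radial-G₁ (suc m) = trans (cong₂ (λ u v → A * u + B * v) (radial-G₁ m) (radial-G₂ (suc m)))
                            (step A B (powℚ (A + B) (suc m)) (powℚ A m) (nat (suc m)))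
    where
    step : ∀ a b s p c → a * (s - two * (a * p) - two * (c * p * b)) + b * (s - two * (a * p))
                         ≡ (a + b) * s - two * (a * (a * p)) - two * ((1ℚ + c) * (a * p) * b)
    step = solve-∀ ℚ-ring

  radial-G : ∀ m → radial A B (suc (suc m)) testProfile
    ≡ powℚ (A + B) (suc (suc m)) - two * (nat (suc (suc m)) * powℚ A (suc m) * B)
      - nat (suc (suc m)) * nat (suc m) * powℚ A m * (B * B)
  radial-G zero = base A B
    where
    base : ∀ a b → a * (a * 1ℚ + b * (- 1ℚ)) + b * (a * (- 1ℚ) + b * (- 1ℚ))
                   ≡ (a + b) * ((a + b) * 1ℚ) - two * ((1ℚ + (1ℚ + 0ℚ)) * (a * 1ℚ) * b)
                     - (1ℚ + (1ℚ + 0ℚ)) * (1ℚ + 0ℚ) * 1ℚ * (b * b)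
    base = solve-∀ ℚ-ring
  radial-G (suc m) = trans (cong₂ (λ u v → A * u + B * v) (radial-G m) (radial-G₁ (suc m)))
                           (step A B (powℚ (A + B) (suc (suc m))) (powℚ A m) (nat (suc m)))
    where
    step : ∀ a b s p c →
      a * (s - two * ((1ℚ + c) * (a * p) * b) - (1ℚ + c) * c * p * (b * b))
        + b * (s - two * (a * (a * p)) - two * ((1ℚ + c) * (a * p) * b))
      ≡ (a + b) * s - two * ((1ℚ + (1ℚ + c)) * (a * (a * p)) * b)
        - (1ℚ + (1ℚ + c)) * (1ℚ + c) * (a * p) * (b * b)
    step = solve-∀ ℚ-ring

open RadialTest using (radial-G)

-- A Padé-type bound (1 + 1/M)^j < (2M + j)/(2M - j) for 1 ≤ j ≤ M, denominators cleared.
-- Induction on j: passing from j to j+1 costs the factor (1+M)(2M-j-1)/(M(2M-j)) on the left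
-- and (2M+j+1)/(2M+j) on the right, and the gap between them is P(j² + 2M + j) ≥ 0.
pade-bound : ∀ m i → suc i ℕ.≤ m →
  powℚ (1ℚ + nat m) (suc i) * (two * nat m - nat (suc i))
    < powℚ (nat m) (suc i) * (two * nat m + nat (suc i))
pade-bound m zero _ = <-from-diff (subst (0ℚ <_) (sym (base-gap (nat m))) 0<1)
  where
  base-gap : ∀ M → M * 1ℚ * (two * M + (1ℚ + 0ℚ)) - (1ℚ + M) * 1ℚ * (two * M - (1ℚ + 0ℚ)) ≡ 1ℚ
  base-gap = solve-∀ ℚ-ring
pade-bound m (suc i) i+2≤m = *-cancelˡ-< 0<D (begin-strict
  D * ((1ℚ + M) * R * E)             ≡⟨ regroup D (1ℚ + M) R E ⟩
  (1ℚ + M) * E * (R * D)             <⟨ *-monoˡ-< 0<[1+M]E (pade-bound m i (ℕP.<⇒≤ i+2≤m)) ⟩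
  (1ℚ + M) * E * (P * (two * M + K)) ≤⟨ ≤-from-diff (subst (0ℚ ≤_) (sym (gap M K P)) 0≤gap) ⟩
  D * (M * P * (two * M + (1ℚ + K))) ∎)
  where
  open QP.≤-Reasoning
  M : ℚ
  M = nat m
  K : ℚ
  K = nat (suc i)
  R : ℚ
  R = powℚ (1ℚ + M) (suc i)
  P : ℚ
  P = powℚ M (suc i)
  E : ℚ
  E = two * M - (1ℚ + K)
  D : ℚ
  D = two * M - K
  regroup : ∀ d a r e → d * (a * r * e) ≡ a * e * (r * d)
  regroup = solve-∀ ℚ-ring
  gap : ∀ M K P → (two * M - K) * (M * P * (two * M + (1ℚ + K))) - (1ℚ + M) * (two * M - (1ℚ + K)) * (P * (two * M + K))
                  ≡ P * (K * K + two * M + K)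
  gap = solve-∀ ℚ-ring
  E-as-sum : ∀ M J → M + (M - J) ≡ two * M - J
  E-as-sum = solve-∀ ℚ-ring
  D-as-sum : ∀ M K → two * M - (1ℚ + K) + 1ℚ ≡ two * M - K
  D-as-sum = solve-∀ ℚ-ring
  1+K≤M : 1ℚ + K ≤ M
  1+K≤M = nat-mono i+2≤m
  0<M : 0ℚ < M
  0<M = QP.<-≤-trans (nat-pos (suc i)) 1+K≤M
  0<E : 0ℚ < E
  0<E = subst (0ℚ <_) (E-as-sum M (1ℚ + K)) (pos-+ 0<M (diff-nonneg 1+K≤M))
  0<D : 0ℚ < D
  0<D = subst (0ℚ <_) (D-as-sum M K) (pos-+ 0<E (QP.<⇒≤ 0<1))
  0<[1+M]E : 0ℚ < (1ℚ + M) * E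
  0<[1+M]E = pos-* (pos-+ 0<1 (QP.<⇒≤ 0<M)) 0<E
  0≤K : 0ℚ ≤ K
  0≤K = nat-nonneg (suc i)
  0≤gap : 0ℚ ≤ P * (K * K + two * M + K)
  0≤gap = nonneg-* (pow-nonneg (suc i) (QP.<⇒≤ 0<M))
                   (nonneg-+ (nonneg-+ (nonneg-* 0≤K 0≤K) (nonneg-* 0≤two (QP.<⇒≤ 0<M))) 0≤K)

-- (1 + 1/M)^M < 3 for M = k+1, i.e. (M+1)^M < 3·M^M: the case j = M of the Padé bound.
power-bound : ∀ k → powℚ (nat (suc (suc k))) (suc k) < three * powℚ (nat (suc k)) (suc k)
power-bound k = *-cancelˡ-< (nat-pos k)
  (subst₂ _<_ (left M X) (right M Y) (pade-bound (suc k) k ℕP.≤-refl))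
  where
  M : ℚ
  M = nat (suc k)
  X : ℚ
  X = powℚ (1ℚ + M) (suc k)
  Y : ℚ
  Y = powℚ M (suc k)
  left : ∀ M X → X * (two * M - M) ≡ M * X
  left = solve-∀ ℚ-ring
  right : ∀ M Y → Y * (two * M + M) ≡ M * (three * Y)
  right = solve-∀ ℚ-ring

-- With A = lM and B = l (l > 0, M = n-1) the radial sum of G over the (k+2)-cube is
-- lⁿ·n·(n^{n-1} - 3M^{n-1}), which is negative by the power bound.
radial-test-negative : ∀ k l → 0ℚ < l → radial (l * nat (suc k)) l (suc (suc k)) testProfile < 0ℚ
radial-test-negative k l 0<l = begin-strict
  radial (l * M) l (suc (suc k)) testProfile
    ≡⟨ radial-G (l * M) l k ⟩
  (l * M + l) * ((l * M + l) * powℚ (l * M + l) k) - two * (N * (l * M * powℚ (l * M) k) * l)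
    - N * M * powℚ (l * M) k * (l * l)
    ≡⟨ cong₂ (λ S Q → (l * M + l) * ((l * M + l) * S) - two * (N * (l * M * Q) * l) - N * M * Q * (l * l))
             pow-sum (pow-mul l M k) ⟩
  (l * M + l) * ((l * M + l) * (L * R)) - two * (N * (l * M * (L * P)) * l) - N * M * (L * P) * (l * l)
    ≡⟨ factorise l M L P R ⟩
  (l * l * L * N) * (N * R - three * (M * P))
    <⟨ pos*neg 0<coefficient (diff-neg (power-bound k)) ⟩
  0ℚ ∎
  where
  open QP.≤-Reasoning
  M : ℚ
  M = nat (suc k)
  N : ℚ
  N = 1ℚ + M
  L : ℚ
  L = powℚ l k
  P : ℚ
  P = powℚ M k
  R : ℚ
  R = powℚ N k
  factor-l : ∀ l M → l * M + l ≡ l * (1ℚ + M)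
  factor-l = solve-∀ ℚ-ring
  pow-sum : powℚ (l * M + l) k ≡ L * R
  pow-sum = trans (cong (λ u → powℚ u k) (factor-l l M)) (pow-mul l N k)
  factorise : ∀ l M L P R →
    (l * M + l) * ((l * M + l) * (L * R)) - two * ((1ℚ + M) * (l * M * (L * P)) * l)
      - (1ℚ + M) * M * (L * P) * (l * l)
    ≡ (l * l * L * (1ℚ + M)) * ((1ℚ + M) * R - three * (M * P))
  factorise = solve-∀ ℚ-ring
  0<coefficient : 0ℚ < l * l * L * N
  0<coefficient = pos-* (pos-* (pos-* 0<l 0<l) (pow-pos k 0<l)) (nat-pos (suc k))

Friendly : ∀ {n} → BoolFun n → Cube n → Cube n → Set
Friendly f x y = (1 ℕ.≤ dH x y × dH x y ℕ.≤ 2) × f y ≡ f x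

friendly? : ∀ {n} (f : BoolFun n) (x y : Cube n) → Dec (Friendly f x y)
friendly? f x y = ((1 ℕ.≤? dH x y) ×-dec (dH x y ℕ.≤? 2)) ×-dec (f y SignP.≟ f x)

product≤1 : ∀ s t → val s * val t ≤ 1ℚ
product≤1 Sign.+ Sign.+ = QP.≤-refl
product≤1 Sign.- Sign.- = QP.≤-refl
product≤1 Sign.+ Sign.- = QP.<⇒≤ (QP.neg<pos (- 1ℚ) 1ℚ)
product≤1 Sign.- Sign.+ = QP.<⇒≤ (QP.neg<pos (- 1ℚ) 1ℚ)

product-of-distinct : ∀ s t → t ≢ s → val s * val t ≡ - 1ℚ
product-of-distinct Sign.+ Sign.+ t≢s = contradiction refl t≢s
product-of-distinct Sign.- Sign.- t≢s = contradiction refl t≢s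
product-of-distinct Sign.+ Sign.- _ = refl
product-of-distinct Sign.- Sign.+ _ = refl

correlation≤profile : ∀ (s t : Sign) d → ¬ ((1 ℕ.≤ d × d ℕ.≤ 2) × t ≡ s) → val s * val t ≤ testProfile d
correlation≤profile s t 0 _ = product≤1 s t
correlation≤profile s t 1 unfriendly =
  QP.≤-reflexive (product-of-distinct s t λ t≡s → unfriendly ((ℕ.s≤s ℕ.z≤n , ℕ.s≤s ℕ.z≤n) , t≡s))
correlation≤profile s t 2 unfriendly =
  QP.≤-reflexive (product-of-distinct s t λ t≡s → unfriendly ((ℕ.s≤s ℕ.z≤n , ℕ.s≤s (ℕ.s≤s ℕ.z≤n)) , t≡s))
correlation≤profile s t (suc (suc (suc _))) _ = product≤1 s t

sgn-neg : ∀ q → q < 0ℚ → sgn q ≡ -[1+ 0 ]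
sgn-neg q q<0 with q QP.<? 0ℚ
... | yes _ = refl
... | no q≮0 = contradiction q<0 q≮0

sgn-pos : ∀ q → 0ℚ < q → sgn q ≡ + 1
sgn-pos q 0<q with q QP.<? 0ℚ
... | yes q<0 = contradiction q<0 (QP.<-asym 0<q)
... | no _ with q QP.≟ 0ℚ
...   | yes q≡0 = contradiction (sym q≡0) (λ 0≡q → QP.<-irrefl 0≡q 0<q)
...   | no _ = refl

negative-correlation-violates-SP : ∀ (s : Sign) τ → val s * τ < 0ℚ → ¬ (τ ≢ 0ℚ → signℤ s ≡ sgn τ)
negative-correlation-violates-SP Sign.+ τ sτ<0 sp =
  contradiction (trans (sp (λ τ≡0 → QP.<-irrefl τ≡0 τ<0)) (sgn-neg τ τ<0)) λ ()
  where
  τ<0 : τ < 0ℚ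
  τ<0 = subst (_< 0ℚ) (QP.*-identityˡ τ) sτ<0
negative-correlation-violates-SP Sign.- τ sτ<0 sp =
  contradiction (trans (sp (λ τ≡0 → QP.<-irrefl (sym τ≡0) 0<τ)) (sgn-pos τ 0<τ)) λ ()
  where
  cancel : ∀ t → t + (- 1ℚ) * t ≡ 0ℚ
  cancel = solve-∀ ℚ-ring
  0<τ : 0ℚ < τ
  0<τ = subst₂ _<_ (cancel τ) (QP.+-identityʳ τ) (QP.+-monoʳ-< τ sτ<0)

-- The noise level.  For the (k+2)-cube we take ρ = 1 - ℓ with ℓ = 2/(k+2); then the kernel
-- weights are 1+ρ = ℓ·(k+1) and 1-ρ = ℓ.

ℓ : ℕ → ℚ
ℓ k = two * (1/ nat (suc (suc k))) {{Q.>-nonZero (nat-pos (suc k))}}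

module NoiseLevel (k : ℕ) where

  N : ℚ
  N = nat (suc (suc k))
  q : ℚ
  q = (1/ N) {{Q.>-nonZero (nat-pos (suc k))}}

  q*N≡1 : q * N ≡ 1ℚ
  q*N≡1 = QP.*-inverseˡ N {{Q.>-nonZero (nat-pos (suc k))}}

  0<q : 0ℚ < q
  0<q = QP.positive⁻¹ q {{QP.1/pos⇒pos N {{Q.positive (nat-pos (suc k))}}}}

  ℓ-pos : 0ℚ < ℓ k
  ℓ-pos = pos-* (QP.positive⁻¹ two) 0<q

  ℓ-agree : 1ℚ + (1ℚ - ℓ k) ≡ ℓ k * nat (suc k)
  ℓ-agree = begin
    1ℚ + (1ℚ - two * q)               ≡⟨ unfold q ⟩
    two * 1ℚ - two * q                ≡⟨ cong (λ u → two * u - two * q) (sym q*N≡1) ⟩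
    two * (q * N) - two * q           ≡⟨ collect q (nat (suc k)) ⟩
    two * q * nat (suc k)             ∎
    where
    open ≡-Reasoning
    unfold : ∀ q → 1ℚ + (1ℚ - two * q) ≡ two * 1ℚ - two * q
    unfold = solve-∀ ℚ-ring
    collect : ∀ q M → two * (q * (1ℚ + M)) - two * q ≡ two * q * M
    collect = solve-∀ ℚ-ring

  ℓ-disagree : 1ℚ - (1ℚ - ℓ k) ≡ ℓ k
  ℓ-disagree = cancel (ℓ k)
    where
    cancel : ∀ l → 1ℚ - (1ℚ - l) ≡ l
    cancel = solve-∀ ℚ-ring

  ℓ<ε : ∀ ε → (+ 2) / 1 < (+ suc (suc k)) / 1 * ε → ℓ k < ε
  ℓ<ε ε 2<nε = subst₂ _<_ (QP.*-comm q two) q[Nε]≡ε (*-monoˡ-< 0<q 2<Nε)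
    where
    2<Nε : two < N * ε
    2<Nε = subst (λ u → two < u * ε) (sym (nat≡/1 (suc (suc k)))) 2<nε
    q[Nε]≡ε : q * (N * ε) ≡ ε
    q[Nε]≡ε = trans (sym (QP.*-assoc q N ε)) (trans (cong (_* ε) q*N≡1) (QP.*-identityˡ ε))

  ρ-in-range : ∀ ε → ℓ k < ε → 1ℚ - ε < 1ℚ - ℓ k × 1ℚ - ℓ k ≤ 1ℚ
  ρ-in-range ε ℓ<ε = QP.+-monoʳ-< 1ℚ (QP.neg-antimono-< ℓ<ε)
                   , QP.+-monoʳ-≤ 1ℚ (QP.neg-antimono-≤ (QP.<⇒≤ ℓ-pos))

  -- Core of the proof: at ρ = 1 - ℓ, a ρ-SP function on the (k+2)-cube has a friendly
  -- neighbour of x, since otherwise f(x)·T_ρ f(x) ≤ 2^{-n} R(G) < 0.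
  no-lonely-point : ∀ (f : BoolFun (suc (suc k))) (x : Cube (suc (suc k))) → IsSP (1ℚ - ℓ k) f →
    ¬ All (λ z → ¬ Friendly f x z) (allPoints (suc (suc k)))
  no-lonely-point f x sp lonely =
    negative-correlation-violates-SP (f x) (T ρ f x) f[x]T[x]<0 (sp x)
    where
    n : ℕ
    n = suc (suc k)
    ρ : ℚ
    ρ = 1ℚ - ℓ k
    Ps : List (Cube n)
    Ps = allPoints n
    0≤A : 0ℚ ≤ 1ℚ + ρ
    0≤A = subst (0ℚ ≤_) (sym ℓ-agree) (nonneg-* (QP.<⇒≤ ℓ-pos) (nat-nonneg (suc k)))
    0≤B : 0ℚ ≤ 1ℚ - ρ
    0≤B = subst (0ℚ ≤_) (sym ℓ-disagree) (QP.<⇒≤ ℓ-pos)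
    correlation≤radial : ∑[ z ∈ Ps ] kernel ρ z x * (val (f x) * val (f z)) ≤ radial (1ℚ + ρ) (1ℚ - ρ) n testProfile
    correlation≤radial = QP.≤-trans
      (sum-mono Ps (All.map (λ {z} z-unfriendly →
         *-monoˡ-≤ (kernel-nonneg ρ 0≤A 0≤B z x) (correlation≤profile (f x) (f z) (dH x z) z-unfriendly)) lonely))
      (QP.≤-reflexive (kernel-radial ρ n x testProfile))
    radial<0 : radial (1ℚ + ρ) (1ℚ - ρ) n testProfile < 0ℚ
    radial<0 = subst₂ (λ A B → radial A B n testProfile < 0ℚ) (sym ℓ-agree) (sym ℓ-disagree)
                      (radial-test-negative k (ℓ k) ℓ-pos)
    f[x]T[x]<0 : val (f x) * T ρ f x < 0ℚ
    f[x]T[x]<0 = subst (_< 0ℚ) (sym (correlation-as-kernel ρ n f x))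
                       (pos*neg (uniform-pos n) (QP.≤-<-trans correlation≤radial radial<0))

  friendly-neighbour : ∀ (f : BoolFun (suc (suc k))) → IsSP (1ℚ - ℓ k) f → ∀ x → ∃[ y ] Friendly f x y
  friendly-neighbour f sp x with any? (friendly? f x) (allPoints (suc (suc k)))
  ... | yes found = satisfied found
  ... | no none = ⊥-elim (no-lonely-point f x sp (¬Any⇒All¬ _ none))

-- Proposition 4.5, with γ = 1: for n ≥ 2 the hypothesis 2 < nε makes f SP at ρ = 1 - 2/n.
proposition4p5 : Σ ℕ λ γ →
    ∀ (ε : ℚ) → 0ℚ < ε →
    ∀ (n : ℕ) → (f : BoolFun n) →
    (∀ (ρ : ℚ) → 1ℚ - ε < ρ → ρ ≤ 1ℚ → IsSP ρ f) →
    (+ 2) / 1 < (+ n) / 1 * ε →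
    γ ℕ.< n →
    ∀ (x : Cube n) →
    ∃[ y ] ((1 ℕ.≤ dH x y × dH x y ℕ.≤ 2) × f y ≡ f x)
proposition4p5 = 1 , λ where
  ε _ (suc (suc k)) f SP-near-1 2<nε (ℕ.s≤s (ℕ.s≤s ℕ.z≤n)) →
    let open NoiseLevel k
        (ρ>1-ε , ρ≤1) = ρ-in-range ε (ℓ<ε ε 2<nε)
    in friendly-neighbour f (SP-near-1 (1ℚ - ℓ k) ρ>1-ε ρ≤1)
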